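{- There exist a set $X$ and two states $R_1,R_2$ of $X$ in $\mathrm{CPM}(\mathbf{Rel})$, neither of which is pure, such that their union $R_1\cup R_2$ (as relations) is a pure state of $X$.
   Context: $\mathbf{Rel}$ is the category of sets and binary relations, with dagger given by the converse relation. A relation $P: X\to X$ is positive if $P=S^\dagger\circ S$ for some set $Y$ and relation $S: X\to Y$. A state of $X$ in $\mathrm{CPM}(\mathbf{Rel})$ is a morphism $\{*\}\to X$ in $\mathrm{CPM}(\mathbf{Rel})$; concretely it is a positive relation $R\subseteq X\times X$. A state is pure if it is of the form $U\circ U^\dagger$ for some subset $U\subseteq X$ viewed as a relation $U:\{*\}\to X$, i.e. $R(x,x')\iff x\in U\wedge x'\in U$ (these are the images of the states of $\mathbf{Rel}$ under the embedding $f\mapsto f\otimes f$). -}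

module Defs where

open import Data.Product using (Σ; _×_; ∃)
open import Data.Sum using (_⊎_)
open import Function.Bundles using (_⇔_)

-- A (binary) relation X → Y in Rel, as a proof-relevant predicate on X × Y.
Rel : Set → Set → Set₁
Rel X Y = X → Y → Set

_≐_ : {X Y : Set} → Rel X Y → Rel X Y → Set
_≐_ {X} {Y} R R' = (x : X) (y : Y) → R x y ⇔ R' x y

-- Composite S† ∘ S : X → X for S : X → Y.
dagComp : {X Y : Set} → Rel X Y → Rel X X
dagComp {X} {Y} S x x' = Σ Y (λ y → S x y × S x' y)

-- Positive relation: R = S† ∘ S for some set Y and S : X → Y.
-- A state of X in CPM(Rel) is exactly a positive relation on X.
IsState : {X : Set} → Rel X X → Set₁
IsState {X} R = Σ Set (λ Y → Σ (Rel X Y) (λ S → R ≐ dagComp S))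

-- Pure state: R = U ∘ U† for a subset U ⊆ X, i.e. R x x' ⇔ x ∈ U ∧ x' ∈ U.
IsPure : {X : Set} → Rel X X → Set₁
IsPure {X} R = Σ (X → Set) (λ U → (x x' : X) → R x x' ⇔ (U x × U x'))

_∪_ : {X Y : Set} → Rel X Y → Rel X Y → Rel X Y
(R ∪ R') x y = R x y ⊎ R' x y

module Submission where

-- States of X in CPM(Rel) are the relations S† ∘ S; taking S to be the
-- membership relation of a family of "blocks" Uᵢ ⊆ X gives the state ⋃ᵢ Uᵢ × Uᵢ.
-- A pure state U × U has the rectangle property: R x x and R y y imply R x y.
-- So a union of overlapping squares that is not itself a square is impure,
-- yet two such unions can together cover X × X, which is the pure state X × X.

open import Defs
open import Data.Product using (Σ; _×_; _,_)
open import Data.Sum using (_⊎_; inj₁; inj₂; [_,_]′)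
open import Data.Unit using (⊤; tt)
open import Data.Bool using (Bool; true; false)
open import Relation.Nullary using (¬_)
open import Function.Bundles using (mk⇔; module Equivalence)
open import Function.Base using (id)

open Equivalence using (to; from)

dagComp-isState : {X Y : Set} (S : Rel X Y) → IsState (dagComp S)
dagComp-isState {Y = Y} S = Y , S , λ _ _ → mk⇔ id id

∪-isState : {X : Set} {R R' : Rel X X} → IsState R → IsState R' → IsState (R ∪ R')
∪-isState {X} {R} {R'} (Y , S , R≐) (Y' , T , R'≐) =
  (Y ⊎ Y') , ST , λ x y → mk⇔ (into x y) (outof x y)
  where
  ST : Rel X (Y ⊎ Y')
  ST x = [ S x , T x ]′

  into : (x y : X) → (R ∪ R') x y → dagComp ST x y
  into x y (inj₁ r) with to (R≐ x y) r
  ... | z , p , q = inj₁ z , p , q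
  into x y (inj₂ r) with to (R'≐ x y) r
  ... | z , p , q = inj₂ z , p , q

  outof : (x y : X) → dagComp ST x y → (R ∪ R') x y
  outof x y (inj₁ z , p , q) = inj₁ (from (R≐ x y) (z , p , q))
  outof x y (inj₂ z , p , q) = inj₂ (from (R'≐ x y) (z , p , q))

pure-rectangle : {X : Set} {R : Rel X X} → IsPure R → {x y : X} → R x x → R y y → R x y
pure-rectangle (U , R⇔) {x} {y} Rxx Ryy with to (R⇔ x x) Rxx | to (R⇔ y y) Ryy
... | Ux , _ | Uy , _ = from (R⇔ x y) (Ux , Uy)

total-isPure : {X : Set} {R : Rel X X} → ((x y : X) → R x y) → IsPure R
total-isPure total = (λ _ → ⊤) , λ x y → mk⇔ (λ _ → tt , tt) (λ _ → total x y)

data Point : Set where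
  a b c : Point

-- Blocks of R₁ (a point x lies in block i iff Blocks₁ x i): true ↦ {a, b}, false ↦ {c}.
data Blocks₁ : Point → Bool → Set where
  a∈ab : Blocks₁ a true
  b∈ab : Blocks₁ b true
  c∈c  : Blocks₁ c false

data Blocks₂ : Point → Bool → Set where
  b∈bc : Blocks₂ b true
  c∈bc : Blocks₂ c true
  a∈ac : Blocks₂ a false
  c∈ac : Blocks₂ c false

R₁ R₂ : Rel Point Point
R₁ = dagComp Blocks₁
R₂ = dagComp Blocks₂

-- a and c share no block of R₁, although both lie on its diagonal.
R₁-impure : ¬ IsPure R₁
R₁-impure pure with pure-rectangle pure (true , a∈ab , a∈ab) (false , c∈c , c∈c)
... | true  , a∈ab , ()
... | false , ()   , _

-- a and b share no block of R₂, although both lie on its diagonal.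
R₂-impure : ¬ IsPure R₂
R₂-impure pure with pure-rectangle pure (false , a∈ac , a∈ac) (true , b∈bc , b∈bc)
... | true  , ()   , _
... | false , a∈ac , ()

R₁∪R₂-total : (x y : Point) → (R₁ ∪ R₂) x y
R₁∪R₂-total a a = inj₁ (true , a∈ab , a∈ab)
R₁∪R₂-total a b = inj₁ (true , a∈ab , b∈ab)
R₁∪R₂-total a c = inj₂ (false , a∈ac , c∈ac)
R₁∪R₂-total b a = inj₁ (true , b∈ab , a∈ab)
R₁∪R₂-total b b = inj₁ (true , b∈ab , b∈ab)
R₁∪R₂-total b c = inj₂ (true , b∈bc , c∈bc)
R₁∪R₂-total c a = inj₂ (false , c∈ac , a∈ac)
R₁∪R₂-total c b = inj₂ (true , c∈bc , b∈bc)
R₁∪R₂-total c c = inj₁ (false , c∈c , c∈c)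

lemma3p6 : Σ Set (λ X → Σ (Rel X X) (λ R₁ → Σ (Rel X X) (λ R₂ →
    IsState R₁ × IsState R₂ × ¬ IsPure R₁ × ¬ IsPure R₂
    × IsState (R₁ ∪ R₂) × IsPure (R₁ ∪ R₂))))
lemma3p6 = Point , R₁ , R₂
         , R₁-state , R₂-state
         , R₁-impure , R₂-impure
         , ∪-isState R₁-state R₂-state
         , total-isPure R₁∪R₂-total
  where
  R₁-state : IsState R₁
  R₁-state = dagComp-isState Blocks₁
  R₂-state : IsState R₂
  R₂-state = dagComp-isState Blocks₂
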